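{- Let $q$ be rational and $p$ an odd prime, $p\notin\mathcal D(q)$, and let $\xi=\xi(p)$ be the index of appearance. Then $\xi(p)$ is odd if and only if $p\in\Pi_0(q)\cup\Pi_1(q)$. If $p\in\Pi_0(q)$ then $C_\xi(q)\equiv2$ and $U_{\xi+1}(q)\equiv1\pmod p$. If $p\in\Pi_1(q)$ then $C_\xi(q)\equiv-2$ and $U_{\xi+1}(q)\equiv-1\pmod p$. If $\xi(p)=2k$ then $C_k(q)\equiv0$, $C_\xi(q)\equiv-2$ and $U_{\xi+1}(q)\equiv-1\pmod p$.
   Context: Chebyshev polynomials: $U_0=0$, $U_1=1$, $U_{n+1}=qU_n-U_{n-1}$; $C_n=U_{n+1}-U_{n-1}$; for odd $n=2k+1$, $V_n=U_{k+1}-U_k$, $W_n=U_{k+1}+U_k$. For rational $q=a/b$ in lowest terms, $\mathcal D(q)$ is the set of prime divisors of $b$; congruences mod $p\nmid b$ are in $\mathbb F_p$. For an odd prime $p\notin\mathcal D(q)$: $p\in\Pi_0(q)$ if $W_n(q)\equiv0\bmod p$ for some odd $n\ge1$; $p\in\Pi_1(q)$ if $V_n(q)\equiv0\bmod p$ for some odd $n\ge1$. The index of appearance $\xi(p)$ is the smallest integer $k\ge1$ with $U_k(q)\equiv0\pmod p$. -}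

module Defs where

open import Data.Nat using (ℕ; zero; suc)
open import Data.Integer using (ℤ; +_)
open import Data.Integer.Divisibility using (_∣_)
import Data.Nat.Divisibility as ℕD
open import Data.Product using (_×_)
open import Data.Nat using (_≤_)
open import Data.Rational using (ℚ; 0ℚ; 1ℚ; _+_; _*_; _-_; -_)
import Data.Rational as ℚ
open import Data.Product using (∃)
open import Relation.Nullary using (¬_)

U : ℚ → ℕ → ℚ
U q zero = 0ℚ
U q (suc zero) = 1ℚ
U q (suc (suc n)) = q * U q (suc n) - U q n

2ℚ : ℚ
2ℚ = 1ℚ + 1ℚ

-- C_n = U_{n+1} - U_{n-1}; with U_{-1} = -1 (from the recurrence), C_0 = 2.
C : ℚ → ℕ → ℚ
C q zero = 2ℚ
C q (suc n) = U q (suc (suc n)) - U q n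

-- For odd n = 2k+1:  V_n = U_{k+1} - U_k,  W_n = U_{k+1} + U_k.
-- Here indexed by k, i.e.  Vodd q k = V_{2k+1}(q),  Wodd q k = W_{2k+1}(q).
Vodd : ℚ → ℕ → ℚ
Vodd q k = U q (suc k) - U q k

Wodd : ℚ → ℕ → ℚ
Wodd q k = U q (suc k) + U q k

InD : ℕ → ℚ → Set
InD p q = p ℕD.∣ ℚ.denominatorℕ q

-- Congruence mod p of rationals whose denominators are prime to p
-- (i.e. equality in 𝔽_p after reduction): p divides the numerator of x - y.
_≡[_]_ : ℚ → ℕ → ℚ → Set
x ≡[ p ] y = (+ p) ∣ ℚ.numerator (x - y)

infix 4 _≡[_]_

InΠ₀ : ℕ → ℚ → Set
InΠ₀ p q = ∃ λ k → Wodd q k ≡[ p ] 0ℚ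

InΠ₁ : ℕ → ℚ → Set
InΠ₁ p q = ∃ λ k → Vodd q k ≡[ p ] 0ℚ

IsIndexOfAppearance : ℕ → ℚ → ℕ → Set
IsIndexOfAppearance p q ξ =
  (1 ≤ ξ) × (U q ξ ≡[ p ] 0ℚ) ×
  (∀ k → 1 ≤ k → U q k ≡[ p ] 0ℚ → ξ ≤ k)

{-# OPTIONS --safe #-}
module Submission where

-- Reduce mod p: as p ∤ den q, every U_n(q) is p-integral. Put ε = U_{ξ+1}. The addition
-- formula U_{m+n+1} = U_{m+1} U_{n+1} − U_m U_n and U_ξ ≡ 0 give U_{n+ξ} ≡ ε U_n, and
-- Cassini's identity gives ε² ≡ 1; so the zeros of U are exactly the multiples of ξ, and
-- U_{jξ+1} ≡ εʲ. Since U_{2k+1} = W_{2k+1} V_{2k+1}, ξ is odd iff some W or V vanishes;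
-- then 2k+1 is an odd multiple of ξ, so ε ≡ U_{2k+2}, and the identities
-- U_{2k+2} = 1 + W (q U_{k+1} − W) = −1 + V (q U_{k+1} + V) give ε ≡ 1, resp. ε ≡ −1.
-- If ξ = 2k then U_ξ = U_k C_k with U_k ≢ 0, so C_k ≡ 0 and ε = −1 + U_{k+1} C_k ≡ −1.
-- Finally C_ξ = U_{ξ+1} − U_{ξ−1} ≡ 2ε.

open import Defs
open import Data.Nat using (ℕ; zero; suc)
open import Data.Rational using (ℚ; 1ℚ; -_)
open import Data.Nat.Primality using (Prime; euclidsLemma; ¬prime[1])
open import Data.Product using (_×_; _,_; ∃; proj₁; proj₂)
open import Data.Sum as Sum using (_⊎_; inj₁; inj₂; [_,_]′)
open import Function using (_∘_; id)
open import Data.Empty using (⊥-elim)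
open import Relation.Nullary using (¬_)
open import Relation.Binary.PropositionalEquality
  using (_≡_; refl; sym; trans; cong; cong₂; subst; module ≡-Reasoning)

module ReductionModPrime {p : ℕ} (p-prime : Prime p) where

  import Data.Nat as ℕ
  open import Data.Nat.Divisibility using (_∣_; _∣0; ∣m⇒∣m*n; ∣n⇒∣m*n; ∣1⇒≡1)
  import Data.Nat.Coprimality as Coprimality
  open import Data.Integer as ℤ using (+_)
  open import Data.Integer.Properties using (abs-*)
  import Data.Integer.Divisibility.Signed as ℤ∣
  open import Data.Rational using (mkℚ; toℚᵘ; 0ℚ; _+_; _-_; _*_)
  import Data.Rational as ℚ
  open import Data.Rational.Properties using (toℚᵘ-homo-+; toℚᵘ-homo-*; toℚᵘ-homo‿-; +-inverseʳ)
  open import Data.Rational.Unnormalised as ℚᵘ using (ℚᵘ; _≃_; *≡*)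
  open import Data.Rational.Solver using (module +-*-Solver)
  open +-*-Solver
  open import Relation.Binary.Bundles using (PartialSetoid)

  p∤1 : ¬ p ∣ 1
  p∤1 p∣1 = ¬prime[1] (subst Prime (∣1⇒≡1 p∣1) p-prime)

  ∣-cancelʳ : ∀ {m n} → ¬ p ∣ n → p ∣ m ℕ.* n → p ∣ m
  ∣-cancelʳ {m} {n} p∤n p∣mn = [ id , ⊥-elim ∘ p∤n ]′ (euclidsLemma m n p-prime p∣mn)

  ∤-* : ∀ {m n} → ¬ p ∣ m → ¬ p ∣ n → ¬ p ∣ m ℕ.* n
  ∤-* p∤m p∤n p∣mn = p∤m (∣-cancelʳ p∤n p∣mn)

  Integral : ℚ → Set
  Integral x = ¬ p ∣ ℚ.denominatorℕ x

  Integralᵘ : ℚᵘ → Set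
  Integralᵘ y = ¬ p ∣ ℚᵘ.denominatorℕ y

  -- For p-integral x, Null x says that x maps to 0 in 𝔽ₚ.
  Null : ℚ → Set
  Null x = p ∣ ℤ.∣ ℚ.numerator x ∣

  Nullᵘ : ℚᵘ → Set
  Nullᵘ y = p ∣ ℤ.∣ ℚᵘ.numerator y ∣

  private
    cross-multiply : ∀ x y → toℚᵘ x ≃ y →
      ℤ.∣ ℚ.numerator x ∣ ℕ.* ℚᵘ.denominatorℕ y ≡ ℤ.∣ ℚᵘ.numerator y ∣ ℕ.* ℚ.denominatorℕ x
    cross-multiply (mkℚ n d _) y (*≡* eq) =
      trans (sym (abs-* n (ℚᵘ.denominator y))) (trans (cong ℤ.∣_∣ eq) (abs-* (ℚᵘ.numerator y) (+ suc d)))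

  -- x is in lowest terms, so p cannot divide both its numerator and its denominator.
  integralᵘ⇒integral : ∀ x y → toℚᵘ x ≃ y → Integralᵘ y → Integral x
  integralᵘ⇒integral x@(mkℚ n d coprime) y x≃y p∤y p∣x = ¬prime[1] (subst Prime p≡1 p-prime)
    where
    p∣n : p ∣ ℤ.∣ n ∣
    p∣n = ∣-cancelʳ p∤y (subst (p ∣_) (sym (cross-multiply x y x≃y)) (∣n⇒∣m*n ℤ.∣ ℚᵘ.numerator y ∣ p∣x))
    p≡1 : p ≡ 1
    p≡1 = Coprimality.recompute coprime (p∣n , p∣x)

  nullᵘ⇒null : ∀ x y → toℚᵘ x ≃ y → Integralᵘ y → Nullᵘ y → Null x
  nullᵘ⇒null x y x≃y p∤y p∣y =
    ∣-cancelʳ p∤y (subst (p ∣_) (sym (cross-multiply x y x≃y)) (∣m⇒∣m*n _ p∣y))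

  null⇒nullᵘ : ∀ x y → toℚᵘ x ≃ y → Integral x → Null x → Nullᵘ y
  null⇒nullᵘ x y x≃y p∤x p∣x =
    ∣-cancelʳ p∤x (subst (p ∣_) (cross-multiply x y x≃y) (∣m⇒∣m*n _ p∣x))

  integral-0 : Integral 0ℚ
  integral-0 = p∤1

  integral-1 : Integral 1ℚ
  integral-1 = p∤1

  integral-+ : ∀ x y → Integral x → Integral y → Integral (x + y)
  integral-+ x@(mkℚ _ _ _) y@(mkℚ _ _ _) p∤x p∤y =
    integralᵘ⇒integral (x + y) _ (toℚᵘ-homo-+ x y) (∤-* p∤x p∤y)

  integral-* : ∀ x y → Integral x → Integral y → Integral (x * y)
  integral-* x@(mkℚ _ _ _) y@(mkℚ _ _ _) p∤x p∤y =
    integralᵘ⇒integral (x * y) _ (toℚᵘ-homo-* x y) (∤-* p∤x p∤y)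

  integral-neg : ∀ x → Integral x → Integral (- x)
  integral-neg x@(mkℚ _ _ _) p∤x = integralᵘ⇒integral (- x) _ (toℚᵘ-homo‿- x) p∤x

  integral-sub : ∀ x y → Integral x → Integral y → Integral (x - y)
  integral-sub x y p∤x p∤y = integral-+ x (- y) p∤x (integral-neg y p∤y)

  integral-U : ∀ q → Integral q → ∀ n → Integral (U q n)
  integral-U q p∤q zero = integral-0
  integral-U q p∤q (suc zero) = integral-1
  integral-U q p∤q (suc (suc n)) =
    integral-sub (q * U q (suc n)) (U q n)
      (integral-* q (U q (suc n)) p∤q (integral-U q p∤q (suc n))) (integral-U q p∤q n)

  null-0 : Null 0ℚ
  null-0 = p ∣0

  ¬null-1 : ¬ Null 1ℚ
  ¬null-1 = p∤1

  null-+ : ∀ x y → Integral x → Integral y → Null x → Null y → Null (x + y)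
  null-+ x@(mkℚ m d _) y@(mkℚ n e _) p∤x p∤y p∣m p∣n =
    nullᵘ⇒null (x + y) _ (toℚᵘ-homo-+ x y) (∤-* p∤x p∤y)
      (ℤ∣.∣⇒∣ᵤ (ℤ∣.∣m∣n⇒∣m+n (ℤ∣.∣m⇒∣m*n (+ suc e) (ℤ∣.∣ᵤ⇒∣ {+ p} {m} p∣m))
                             (ℤ∣.∣m⇒∣m*n (+ suc d) (ℤ∣.∣ᵤ⇒∣ {+ p} {n} p∣n))))

  null-*ˡ : ∀ x y → Integral x → Integral y → Null x → Null (x * y)
  null-*ˡ x@(mkℚ m _ _) y@(mkℚ n _ _) p∤x p∤y p∣m =
    nullᵘ⇒null (x * y) _ (toℚᵘ-homo-* x y) (∤-* p∤x p∤y)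
      (ℤ∣.∣⇒∣ᵤ (ℤ∣.∣m⇒∣m*n n (ℤ∣.∣ᵤ⇒∣ {+ p} {m} p∣m)))

  null-neg : ∀ x → Integral x → Null x → Null (- x)
  null-neg x@(mkℚ m _ _) p∤x p∣m =
    nullᵘ⇒null (- x) _ (toℚᵘ-homo‿- x) p∤x (ℤ∣.∣⇒∣ᵤ (ℤ∣.∣m⇒∣-m (ℤ∣.∣ᵤ⇒∣ {+ p} {m} p∣m)))

  null-*⇒null⊎null : ∀ x y → Integral x → Integral y → Null (x * y) → Null x ⊎ Null y
  null-*⇒null⊎null x@(mkℚ m _ _) y@(mkℚ n _ _) p∤x p∤y p∣xy =
    euclidsLemma ℤ.∣ m ∣ ℤ.∣ n ∣ p-prime
      (subst (p ∣_) (abs-* m n) (null⇒nullᵘ (x * y) _ (toℚᵘ-homo-* x y) (integral-* x y p∤x p∤y) p∣xy))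

  -- Equality in 𝔽ₚ. It is only a partial equivalence: a rational whose denominator is
  -- divisible by p has no image in 𝔽ₚ and is related to nothing.
  infix 4 _≈_
  record _≈_ (x y : ℚ) : Set where
    constructor mk≈
    field
      integralˡ : Integral x
      integralʳ : Integral y
      congruent : x ≡[ p ] y

  open _≈_ public

  private
    null-≡ : ∀ {x y} → x ≡ y → Null x → Null y
    null-≡ = subst Null

  ≈-refl : ∀ x → Integral x → x ≈ x
  ≈-refl x p∤x = mk≈ p∤x p∤x (null-≡ (sym (+-inverseʳ x)) null-0)

  ≈-sym : ∀ {x y} → x ≈ y → y ≈ x
  ≈-sym {x} {y} (mk≈ p∤x p∤y x≡y) = mk≈ p∤y p∤x
    (null-≡ (solve 2 (λ x y → :- (x :- y) := y :- x) refl x y)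
      (null-neg (x - y) (integral-sub x y p∤x p∤y) x≡y))

  ≈-trans : ∀ {x y z} → x ≈ y → y ≈ z → x ≈ z
  ≈-trans {x} {y} {z} (mk≈ p∤x p∤y x≡y) (mk≈ _ p∤z y≡z) = mk≈ p∤x p∤z
    (null-≡ (solve 3 (λ x y z → (x :- y) :+ (y :- z) := x :- z) refl x y z)
      (null-+ (x - y) (y - z) (integral-sub x y p∤x p∤y) (integral-sub y z p∤y p∤z) x≡y y≡z))

  ≈-partialSetoid : PartialSetoid _ _
  ≈-partialSetoid = record
    { _≈_ = _≈_
    ; isPartialEquivalence = record { sym = ≈-sym ; trans = ≈-trans }
    }

  +-cong : ∀ {x y u v} → x ≈ y → u ≈ v → x + u ≈ y + v
  +-cong {x} {y} {u} {v} (mk≈ p∤x p∤y x≡y) (mk≈ p∤u p∤v u≡v) =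
    mk≈ (integral-+ x u p∤x p∤u) (integral-+ y v p∤y p∤v)
      (null-≡ (solve 4 (λ x y u v → (x :- y) :+ (u :- v) := (x :+ u) :- (y :+ v)) refl x y u v)
        (null-+ (x - y) (u - v) (integral-sub x y p∤x p∤y) (integral-sub u v p∤u p∤v) x≡y u≡v))

  -‿cong : ∀ {x y} → x ≈ y → - x ≈ - y
  -‿cong {x} {y} (mk≈ p∤x p∤y x≡y) = mk≈ (integral-neg x p∤x) (integral-neg y p∤y)
    (null-≡ (solve 2 (λ x y → :- (x :- y) := (:- x) :- (:- y)) refl x y)
      (null-neg (x - y) (integral-sub x y p∤x p∤y) x≡y))

  sub-cong : ∀ {x y u v} → x ≈ y → u ≈ v → x - u ≈ y - v
  sub-cong x≈y u≈v = +-cong x≈y (-‿cong u≈v)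

  *-cong : ∀ {x y u v} → x ≈ y → u ≈ v → x * u ≈ y * v
  *-cong {x} {y} {u} {v} (mk≈ p∤x p∤y x≡y) (mk≈ p∤u p∤v u≡v) =
    mk≈ (integral-* x u p∤x p∤u) (integral-* y v p∤y p∤v)
      (null-≡ (solve 4 (λ x y u v → (x :- y) :* u :+ (u :- v) :* y := x :* u :- y :* v) refl x y u v)
        (null-+ ((x - y) * u) ((u - v) * y)
          (integral-* (x - y) u (integral-sub x y p∤x p∤y) p∤u)
          (integral-* (u - v) y (integral-sub u v p∤u p∤v) p∤y)
          (null-*ˡ (x - y) u (integral-sub x y p∤x p∤y) p∤u x≡y)
          (null-*ˡ (u - v) y (integral-sub u v p∤u p∤v) p∤y u≡v)))

  ≈0⇒null : ∀ {x} → x ≈ 0ℚ → Null x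
  ≈0⇒null {x} x≈0 = null-≡ (solve 1 (λ x → x :- con 0ℚ := x) refl x) (congruent x≈0)

  null⇒≈0 : ∀ {x} → Integral x → Null x → x ≈ 0ℚ
  null⇒≈0 {x} p∤x p∣x = mk≈ p∤x integral-0 (null-≡ (solve 1 (λ x → x := x :- con 0ℚ) refl x) p∣x)

  1≉0 : ¬ 1ℚ ≈ 0ℚ
  1≉0 1≈0 = ¬null-1 (≈0⇒null 1≈0)

  *≈0⇒≈0⊎≈0 : ∀ x y → Integral x → Integral y → x * y ≈ 0ℚ → x ≈ 0ℚ ⊎ y ≈ 0ℚ
  *≈0⇒≈0⊎≈0 x y p∤x p∤y xy≈0 =
    Sum.map (null⇒≈0 p∤x) (null⇒≈0 p∤y) (null-*⇒null⊎null x y p∤x p∤y (≈0⇒null xy≈0))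

module ChebyshevIdentities (q : ℚ) where

  import Data.Nat as ℕ
  open import Data.Nat.Properties using (+-identityʳ)
  open import Data.Rational using (0ℚ; _+_; _-_; _*_)
  open import Data.Rational.Solver using (module +-*-Solver)
  open +-*-Solver
  open ≡-Reasoning

  U-+ : ∀ m n → U q (suc (m ℕ.+ n)) ≡ U q (suc m) * U q (suc n) - U q m * U q n
  U-+ zero n = solve 2 (λ a b → a := con 1ℚ :* a :- con 0ℚ :* b) refl (U q (suc n)) (U q n)
  U-+ (suc zero) n =
    solve 3 (λ q a b → q :* a :- b := (q :* con 1ℚ :- con 0ℚ) :* a :- con 1ℚ :* b) refl
      q (U q (suc n)) (U q n)
  U-+ (suc (suc m)) n = begin
    q * U q (suc (suc m ℕ.+ n)) - U q (suc (m ℕ.+ n))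
      ≡⟨ cong₂ (λ s t → q * s - t) (U-+ (suc m) n) (U-+ m n) ⟩
    q * (U q (suc (suc m)) * c - b * d) - (b * c - a * d)
      ≡⟨ solve 5 (λ q a b c d → q :* ((q :* b :- a) :* c :- b :* d) :- (b :* c :- a :* d)
                            := (q :* (q :* b :- a) :- b) :* c :- (q :* b :- a) :* d) refl
           q a b c d ⟩
    U q (suc (suc (suc m))) * c - U q (suc (suc m)) * d ∎
    where
    a b c d : ℚ
    a = U q m
    b = U q (suc m)
    c = U q (suc n)
    d = U q n

  cassini : ∀ n → U q (suc n) * U q (suc n) - U q n * U q (suc (suc n)) ≡ 1ℚ
  cassini zero = solve 1 (λ q → con 1ℚ :* con 1ℚ :- con 0ℚ :* (q :* con 1ℚ :- con 0ℚ) := con 1ℚ) refl q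
  cassini (suc n) = trans
    (solve 3 (λ q a b → (q :* b :- a) :* (q :* b :- a) :- b :* (q :* (q :* b :- a) :- b)
                      := b :* b :- a :* (q :* b :- a)) refl q (U q n) (U q (suc n)))
    (cassini n)

  private
    double : ∀ k → 2 ℕ.* k ≡ k ℕ.+ k
    double k = cong (k ℕ.+_) (+-identityʳ k)

  U[2k]≡U*C : ∀ k → U q (2 ℕ.* k) ≡ U q k * C q k
  U[2k]≡U*C zero = solve 0 (con 0ℚ := con 0ℚ :* (con 1ℚ :+ con 1ℚ)) refl
  U[2k]≡U*C (suc j) = begin
    U q (2 ℕ.* suc j)
      ≡⟨ cong (λ n → U q (suc (j ℕ.+ n))) (+-identityʳ (suc j)) ⟩
    U q (suc (j ℕ.+ suc j))
      ≡⟨ U-+ j (suc j) ⟩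
    U q (suc j) * U q (suc (suc j)) - U q j * U q (suc j)
      ≡⟨ solve 3 (λ a b c → b :* c :- a :* b := b :* (c :- a)) refl (U q j) (U q (suc j)) (U q (suc (suc j))) ⟩
    U q (suc j) * C q (suc j) ∎

  U[2k+1]≡W*V : ∀ k → U q (suc (2 ℕ.* k)) ≡ Wodd q k * Vodd q k
  U[2k+1]≡W*V k = begin
    U q (suc (2 ℕ.* k))  ≡⟨ cong (λ n → U q (suc n)) (double k) ⟩
    U q (suc (k ℕ.+ k))  ≡⟨ U-+ k k ⟩
    U q (suc k) * U q (suc k) - U q k * U q k
      ≡⟨ solve 2 (λ a b → b :* b :- a :* a := (b :+ a) :* (b :- a)) refl (U q k) (U q (suc k)) ⟩
    Wodd q k * Vodd q k ∎

  U[2k+1]≡-1+U*C : ∀ k → U q (suc (2 ℕ.* k)) ≡ - 1ℚ + U q (suc k) * C q k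
  U[2k+1]≡-1+U*C zero = solve 0 (con 1ℚ := :- con 1ℚ :+ con 1ℚ :* (con 1ℚ :+ con 1ℚ)) refl
  U[2k+1]≡-1+U*C (suc j) = begin
    U q (suc (2 ℕ.* suc j))        ≡⟨ cong (λ n → U q (suc n)) (double (suc j)) ⟩
    U q (suc (suc j ℕ.+ suc j))    ≡⟨ U-+ (suc j) (suc j) ⟩
    c * c - b * b
      ≡⟨ solve 3 (λ a b c → c :* c :- b :* b := :- (b :* b :- a :* c) :+ c :* (c :- a)) refl a b c ⟩
    - (b * b - a * c) + c * (c - a) ≡⟨ cong (λ t → - t + c * (c - a)) (cassini j) ⟩
    - 1ℚ + c * C q (suc j)         ∎
    where
    a b c : ℚ
    a = U q j
    b = U q (suc j)
    c = U q (suc (suc j))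

  U[2k+2]≡1+W*[qU-W] : ∀ k → U q (suc (suc (2 ℕ.* k))) ≡ 1ℚ + Wodd q k * (q * U q (suc k) - Wodd q k)
  U[2k+2]≡1+W*[qU-W] k = begin
    U q (suc (suc (2 ℕ.* k)))  ≡⟨ cong (λ n → U q (suc (suc n))) (double k) ⟩
    U q (suc (suc k ℕ.+ k))    ≡⟨ U-+ (suc k) k ⟩
    (q * b - a) * b - b * a
      ≡⟨ solve 3 (λ q a b → (q :* b :- a) :* b :- b :* a
                          := (b :* b :- a :* (q :* b :- a)) :+ (b :+ a) :* (q :* b :- (b :+ a))) refl q a b ⟩
    (b * b - a * (q * b - a)) + Wodd q k * (q * b - Wodd q k)
      ≡⟨ cong (_+ Wodd q k * (q * b - Wodd q k)) (cassini k) ⟩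
    1ℚ + Wodd q k * (q * b - Wodd q k) ∎
    where
    a b : ℚ
    a = U q k
    b = U q (suc k)

  U[2k+2]≡-1+V*[qU+V] : ∀ k → U q (suc (suc (2 ℕ.* k))) ≡ - 1ℚ + Vodd q k * (q * U q (suc k) + Vodd q k)
  U[2k+2]≡-1+V*[qU+V] k = begin
    U q (suc (suc (2 ℕ.* k)))  ≡⟨ cong (λ n → U q (suc (suc n))) (double k) ⟩
    U q (suc (suc k ℕ.+ k))    ≡⟨ U-+ (suc k) k ⟩
    (q * b - a) * b - b * a
      ≡⟨ solve 3 (λ q a b → (q :* b :- a) :* b :- b :* a
                          := :- (b :* b :- a :* (q :* b :- a)) :+ (b :- a) :* (q :* b :+ (b :- a))) refl q a b ⟩
    - (b * b - a * (q * b - a)) + Vodd q k * (q * b + Vodd q k)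
      ≡⟨ cong (λ t → - t + Vodd q k * (q * b + Vodd q k)) (cassini k) ⟩
    - 1ℚ + Vodd q k * (q * b + Vodd q k) ∎
    where
    a b : ℚ
    a = U q k
    b = U q (suc k)

module OddNumbers where

  open import Data.Nat using (_*_)
  open import Data.Nat.Properties using (*-suc; *-assoc; *-comm; even≢odd)

  Odd : ℕ → Set
  Odd n = ∃ λ m → n ≡ suc (2 * m)

  even⊎odd : ∀ n → (∃ λ m → n ≡ 2 * m) ⊎ Odd n
  even⊎odd zero = inj₁ (0 , refl)
  even⊎odd (suc n) with even⊎odd n
  ... | inj₁ (m , refl) = inj₂ (m , refl)
  ... | inj₂ (m , refl) = inj₁ (suc m , sym (*-suc 2 m))

  odd-*⇒odd : ∀ m n → Odd (m * n) → Odd m × Odd n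
  odd-*⇒odd m n (k , mn≡2k+1) with even⊎odd m | even⊎odd n
  ... | inj₁ (a , refl) | _ = ⊥-elim (even≢odd (a * n) k (trans (sym (*-assoc 2 a n)) mn≡2k+1))
  ... | inj₂ odd-m | inj₂ odd-n = odd-m , odd-n
  ... | inj₂ _ | inj₁ (b , refl) = ⊥-elim (even≢odd (m * b) k (trans 2[mb]≡m[2b] mn≡2k+1))
    where
    2[mb]≡m[2b] : 2 * (m * b) ≡ m * (2 * b)
    2[mb]≡m[2b] = trans (sym (*-assoc 2 m b)) (trans (cong (_* b) (*-comm 2 m)) (*-assoc m 2 b))

module IndexOfAppearance {p : ℕ} (p-prime : Prime p) {q : ℚ} (q-integral : ¬ InD p q)
                         {ξ′ : ℕ} (index : IsIndexOfAppearance p q (suc ξ′)) where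

  import Data.Nat as ℕ
  open import Data.Nat using (_<_; s≤s; z≤n)
  open import Data.Nat.Properties using (<⇒≱; *-suc; +-identityʳ; m<m+n; +-commutativeSemigroup)
  open import Data.Nat.DivMod using (_%_; _/_; m≡m%n+[m/n]*n; m%n<n)
  open import Data.Nat.Divisibility using (_∣_; divides; m%n≡0⇒n∣m)
  open import Algebra.Properties.CommutativeSemigroup +-commutativeSemigroup using (x∙yz≈y∙xz)
  open import Data.Rational using (0ℚ; _+_; _-_; _*_; +-*-rawSemiring)
  open import Algebra.Definitions.RawSemiring +-*-rawSemiring using (_^_)
  open import Data.Rational.Solver using (module +-*-Solver)
  open +-*-Solver
  open ReductionModPrime p-prime
  open ChebyshevIdentities q
  open OddNumbers
  open import Relation.Binary.Reasoning.PartialSetoid ≈-partialSetoid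

  ξ : ℕ
  ξ = suc ξ′

  integral-Uq : ∀ n → Integral (U q n)
  integral-Uq = integral-U q q-integral

  U-refl : ∀ n → U q n ≈ U q n
  U-refl n = ≈-refl (U q n) (integral-Uq n)

  U[ξ]≈0 : U q ξ ≈ 0ℚ
  U[ξ]≈0 = mk≈ (integral-Uq ξ) integral-0 (proj₁ (proj₂ index))

  no-zero-below-ξ : ∀ r → r < ξ → U q r ≈ 0ℚ → r ≡ 0
  no-zero-below-ξ zero r<ξ Ur≈0 = refl
  no-zero-below-ξ (suc r) r<ξ Ur≈0 = ⊥-elim (<⇒≱ r<ξ (proj₂ (proj₂ index) (suc r) (s≤s z≤n) (congruent Ur≈0)))

  ε : ℚ
  ε = U q (suc ξ)

  ε≈-U[ξ-1] : ε ≈ - U q ξ′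
  ε≈-U[ξ-1] = begin
    q * U q ξ - U q ξ′  ≈⟨ sub-cong (*-cong (≈-refl q q-integral) U[ξ]≈0) (U-refl ξ′) ⟩
    q * 0ℚ - U q ξ′     ≡⟨ solve 2 (λ q b → q :* con 0ℚ :- b := :- b) refl q (U q ξ′) ⟩
    - U q ξ′            ∎

  ε*ε≈1 : ε * ε ≈ 1ℚ
  ε*ε≈1 = begin
    ε * ε                              ≈⟨ *-cong ε≈-U[ξ-1] (U-refl (suc ξ)) ⟩
    - U q ξ′ * ε                       ≡⟨ solve 2 (λ b e → (:- b) :* e := con 0ℚ :* con 0ℚ :- b :* e) refl (U q ξ′) ε ⟩
    0ℚ * 0ℚ - U q ξ′ * ε               ≈⟨ sub-cong (*-cong (≈-sym U[ξ]≈0) (≈-sym U[ξ]≈0)) (*-cong (U-refl ξ′) (U-refl (suc ξ))) ⟩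
    U q ξ * U q ξ - U q ξ′ * ε         ≡⟨ cassini ξ′ ⟩
    1ℚ                                 ∎

  ε≉0 : ¬ ε ≈ 0ℚ
  ε≉0 ε≈0 = 1≉0 (begin
    1ℚ       ≈⟨ ≈-sym ε*ε≈1 ⟩
    ε * ε    ≈⟨ *-cong ε≈0 ε≈0 ⟩
    0ℚ * 0ℚ  ≡⟨ solve 0 (con 0ℚ :* con 0ℚ := con 0ℚ) refl ⟩
    0ℚ       ∎)

  U-shift : ∀ n → U q (ξ ℕ.+ n) ≈ ε * U q n
  U-shift n = begin
    U q (suc (ξ′ ℕ.+ n))                      ≡⟨ U-+ ξ′ n ⟩
    U q ξ * U q (suc n) - U q ξ′ * U q n      ≈⟨ sub-cong (*-cong U[ξ]≈0 (U-refl (suc n))) (*-cong (U-refl ξ′) (U-refl n)) ⟩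
    0ℚ * U q (suc n) - U q ξ′ * U q n
      ≡⟨ solve 3 (λ c b d → con 0ℚ :* c :- b :* d := (:- b) :* d) refl (U q (suc n)) (U q ξ′) (U q n) ⟩
    - U q ξ′ * U q n                          ≈⟨ *-cong (≈-sym ε≈-U[ξ-1]) (U-refl n) ⟩
    ε * U q n                                 ∎

  integral-ε^ : ∀ j → Integral (ε ^ j)
  integral-ε^ zero = integral-1
  integral-ε^ (suc j) = integral-* ε (ε ^ j) (integral-Uq (suc ξ)) (integral-ε^ j)

  U-shift-multiple : ∀ j n → U q (n ℕ.+ j ℕ.* ξ) ≈ ε ^ j * U q n
  U-shift-multiple zero n = begin
    U q (n ℕ.+ 0)  ≡⟨ cong (U q) (+-identityʳ n) ⟩
    U q n          ≈⟨ U-refl n ⟩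
    U q n          ≡⟨ solve 1 (λ u → u := con 1ℚ :* u) refl (U q n) ⟩
    1ℚ * U q n     ∎
  U-shift-multiple (suc j) n = begin
    U q (n ℕ.+ (ξ ℕ.+ j ℕ.* ξ))    ≡⟨ cong (U q) (x∙yz≈y∙xz n ξ (j ℕ.* ξ)) ⟩
    U q (ξ ℕ.+ (n ℕ.+ j ℕ.* ξ))    ≈⟨ U-shift (n ℕ.+ j ℕ.* ξ) ⟩
    ε * U q (n ℕ.+ j ℕ.* ξ)        ≈⟨ *-cong (U-refl (suc ξ)) (U-shift-multiple j n) ⟩
    ε * (ε ^ j * U q n)            ≡⟨ solve 3 (λ e x u → e :* (x :* u) := (e :* x) :* u) refl ε (ε ^ j) (U q n) ⟩
    ε ^ suc j * U q n              ∎

  ε^≉0 : ∀ j → ¬ ε ^ j ≈ 0ℚ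
  ε^≉0 zero = 1≉0
  ε^≉0 (suc j) ε^[1+j]≈0 =
    [ ε≉0 , ε^≉0 j ]′ (*≈0⇒≈0⊎≈0 ε (ε ^ j) (integral-Uq (suc ξ)) (integral-ε^ j) ε^[1+j]≈0)

  ε^[2i]≈1 : ∀ i → ε ^ (2 ℕ.* i) ≈ 1ℚ
  ε^[2i]≈1 zero = ≈-refl 1ℚ integral-1
  ε^[2i]≈1 (suc i) = begin
    ε ^ (2 ℕ.* suc i)          ≡⟨ cong (ε ^_) (*-suc 2 i) ⟩
    ε * (ε * ε ^ (2 ℕ.* i))    ≡⟨ solve 2 (λ e x → e :* (e :* x) := (e :* e) :* x) refl ε (ε ^ (2 ℕ.* i)) ⟩
    (ε * ε) * ε ^ (2 ℕ.* i)    ≈⟨ *-cong ε*ε≈1 (ε^[2i]≈1 i) ⟩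
    1ℚ * 1ℚ                    ≡⟨ solve 0 (con 1ℚ :* con 1ℚ := con 1ℚ) refl ⟩
    1ℚ                         ∎

  ε^odd≈ε : ∀ {j} → Odd j → ε ^ j ≈ ε
  ε^odd≈ε (i , refl) = begin
    ε * ε ^ (2 ℕ.* i)  ≈⟨ *-cong (U-refl (suc ξ)) (ε^[2i]≈1 i) ⟩
    ε * 1ℚ             ≡⟨ solve 1 (λ e → e :* con 1ℚ := e) refl ε ⟩
    ε                  ∎

  U≈0⇒ξ∣ : ∀ n → U q n ≈ 0ℚ → ξ ∣ n
  U≈0⇒ξ∣ n Un≈0 = m%n≡0⇒n∣m n ξ (no-zero-below-ξ (n % ξ) (m%n<n n ξ) U[n%ξ]≈0)
    where
    ε^j*U[n%ξ]≈0 : ε ^ (n / ξ) * U q (n % ξ) ≈ 0ℚ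
    ε^j*U[n%ξ]≈0 = begin
      ε ^ (n / ξ) * U q (n % ξ)          ≈⟨ ≈-sym (U-shift-multiple (n / ξ) (n % ξ)) ⟩
      U q (n % ξ ℕ.+ (n / ξ) ℕ.* ξ)      ≡⟨ cong (U q) (sym (m≡m%n+[m/n]*n n ξ)) ⟩
      U q n                              ≈⟨ Un≈0 ⟩
      0ℚ                                 ∎
    U[n%ξ]≈0 : U q (n % ξ) ≈ 0ℚ
    U[n%ξ]≈0 = [ ⊥-elim ∘ ε^≉0 (n / ξ) , id ]′
      (*≈0⇒≈0⊎≈0 (ε ^ (n / ξ)) (U q (n % ξ)) (integral-ε^ (n / ξ)) (integral-Uq (n % ξ)) ε^j*U[n%ξ]≈0)

  U[jξ+1]≈ε^j : ∀ j → U q (suc (j ℕ.* ξ)) ≈ ε ^ j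
  U[jξ+1]≈ε^j j = begin
    U q (1 ℕ.+ j ℕ.* ξ)   ≈⟨ U-shift-multiple j 1 ⟩
    ε ^ j * 1ℚ            ≡⟨ solve 1 (λ x → x :* con 1ℚ := x) refl (ε ^ j) ⟩
    ε ^ j                 ∎

  U[2k+1]≈0⇒odd∧U[2k+2]≈ε : ∀ k → U q (suc (2 ℕ.* k)) ≈ 0ℚ → Odd ξ × U q (suc (suc (2 ℕ.* k))) ≈ ε
  U[2k+1]≈0⇒odd∧U[2k+2]≈ε k U[2k+1]≈0 = from-quotient (U≈0⇒ξ∣ (suc (2 ℕ.* k)) U[2k+1]≈0)
    where
    from-quotient : ξ ∣ suc (2 ℕ.* k) → Odd ξ × U q (suc (suc (2 ℕ.* k))) ≈ ε
    from-quotient (divides j 2k+1≡jξ) =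
      let odd-j , odd-ξ = odd-*⇒odd j ξ (k , sym 2k+1≡jξ) in
      odd-ξ , (begin
        U q (suc (suc (2 ℕ.* k)))   ≡⟨ cong (λ n → U q (suc n)) 2k+1≡jξ ⟩
        U q (suc (j ℕ.* ξ))         ≈⟨ U[jξ+1]≈ε^j j ⟩
        ε ^ j                       ≈⟨ ε^odd≈ε odd-j ⟩
        ε                           ∎)

  integral-Wodd : ∀ k → Integral (Wodd q k)
  integral-Wodd k = integral-+ (U q (suc k)) (U q k) (integral-Uq (suc k)) (integral-Uq k)

  integral-Vodd : ∀ k → Integral (Vodd q k)
  integral-Vodd k = integral-sub (U q (suc k)) (U q k) (integral-Uq (suc k)) (integral-Uq k)

  W≈0⇒U[2k+1]≈0 : ∀ k → Wodd q k ≈ 0ℚ → U q (suc (2 ℕ.* k)) ≈ 0ℚ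
  W≈0⇒U[2k+1]≈0 k W≈0 = begin
    U q (suc (2 ℕ.* k))    ≡⟨ U[2k+1]≡W*V k ⟩
    Wodd q k * Vodd q k    ≈⟨ *-cong W≈0 (≈-refl (Vodd q k) (integral-Vodd k)) ⟩
    0ℚ * Vodd q k          ≡⟨ solve 1 (λ v → con 0ℚ :* v := con 0ℚ) refl (Vodd q k) ⟩
    0ℚ                     ∎

  V≈0⇒U[2k+1]≈0 : ∀ k → Vodd q k ≈ 0ℚ → U q (suc (2 ℕ.* k)) ≈ 0ℚ
  V≈0⇒U[2k+1]≈0 k V≈0 = begin
    U q (suc (2 ℕ.* k))    ≡⟨ U[2k+1]≡W*V k ⟩
    Wodd q k * Vodd q k    ≈⟨ *-cong (≈-refl (Wodd q k) (integral-Wodd k)) V≈0 ⟩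
    Wodd q k * 0ℚ          ≡⟨ solve 1 (λ w → w :* con 0ℚ := con 0ℚ) refl (Wodd q k) ⟩
    0ℚ                     ∎

  odd⇒Π₀⊎Π₁ : Odd ξ → InΠ₀ p q ⊎ InΠ₁ p q
  odd⇒Π₀⊎Π₁ (m , ξ≡2m+1) =
    Sum.map (λ W≈0 → m , congruent W≈0) (λ V≈0 → m , congruent V≈0)
      (*≈0⇒≈0⊎≈0 (Wodd q m) (Vodd q m) (integral-Wodd m) (integral-Vodd m) W*V≈0)
    where
    W*V≈0 : Wodd q m * Vodd q m ≈ 0ℚ
    W*V≈0 = begin
      Wodd q m * Vodd q m    ≡⟨ sym (U[2k+1]≡W*V m) ⟩
      U q (suc (2 ℕ.* m))    ≡⟨ cong (U q) (sym ξ≡2m+1) ⟩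
      U q ξ                  ≈⟨ U[ξ]≈0 ⟩
      0ℚ                     ∎

  Π₀⇒odd∧ε≈1 : InΠ₀ p q → Odd ξ × ε ≈ 1ℚ
  Π₀⇒odd∧ε≈1 (k , W≡0) =
    let odd-ξ , U[2k+2]≈ε = U[2k+1]≈0⇒odd∧U[2k+2]≈ε k (W≈0⇒U[2k+1]≈0 k W≈0) in
    odd-ξ , (begin
      ε                                          ≈⟨ ≈-sym U[2k+2]≈ε ⟩
      U q (suc (suc (2 ℕ.* k)))                  ≡⟨ U[2k+2]≡1+W*[qU-W] k ⟩
      1ℚ + Wodd q k * X                          ≈⟨ +-cong (≈-refl 1ℚ integral-1) (*-cong W≈0 (≈-refl X integral-X)) ⟩
      1ℚ + 0ℚ * X                                ≡⟨ solve 1 (λ x → con 1ℚ :+ con 0ℚ :* x := con 1ℚ) refl X ⟩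
      1ℚ                                         ∎)
    where
    W≈0 : Wodd q k ≈ 0ℚ
    W≈0 = mk≈ (integral-Wodd k) integral-0 W≡0
    X : ℚ
    X = q * U q (suc k) - Wodd q k
    integral-X : Integral X
    integral-X = integral-sub (q * U q (suc k)) (Wodd q k)
      (integral-* q (U q (suc k)) q-integral (integral-Uq (suc k))) (integral-Wodd k)

  Π₁⇒odd∧ε≈-1 : InΠ₁ p q → Odd ξ × ε ≈ - 1ℚ
  Π₁⇒odd∧ε≈-1 (k , V≡0) =
    let odd-ξ , U[2k+2]≈ε = U[2k+1]≈0⇒odd∧U[2k+2]≈ε k (V≈0⇒U[2k+1]≈0 k V≈0) in
    odd-ξ , (begin
      ε                                          ≈⟨ ≈-sym U[2k+2]≈ε ⟩
      U q (suc (suc (2 ℕ.* k)))                  ≡⟨ U[2k+2]≡-1+V*[qU+V] k ⟩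
      - 1ℚ + Vodd q k * X                        ≈⟨ +-cong (≈-refl (- 1ℚ) (integral-neg 1ℚ integral-1)) (*-cong V≈0 (≈-refl X integral-X)) ⟩
      - 1ℚ + 0ℚ * X                              ≡⟨ solve 1 (λ x → :- con 1ℚ :+ con 0ℚ :* x := :- con 1ℚ) refl X ⟩
      - 1ℚ                                       ∎)
    where
    V≈0 : Vodd q k ≈ 0ℚ
    V≈0 = mk≈ (integral-Vodd k) integral-0 V≡0
    X : ℚ
    X = q * U q (suc k) + Vodd q k
    integral-X : Integral X
    integral-X = integral-+ (q * U q (suc k)) (Vodd q k)
      (integral-* q (U q (suc k)) q-integral (integral-Uq (suc k))) (integral-Vodd k)

  C[ξ]≈ε+ε : C q ξ ≈ ε + ε
  C[ξ]≈ε+ε = +-cong (U-refl (suc ξ)) (≈-sym ε≈-U[ξ-1])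

  ε≈1⇒C[ξ]≈2 : ε ≈ 1ℚ → C q ξ ≈ 2ℚ
  ε≈1⇒C[ξ]≈2 ε≈1 = ≈-trans C[ξ]≈ε+ε (+-cong ε≈1 ε≈1)

  ε≈-1⇒C[ξ]≈-2 : ε ≈ - 1ℚ → C q ξ ≈ - 2ℚ
  ε≈-1⇒C[ξ]≈-2 ε≈-1 = begin
    C q ξ          ≈⟨ C[ξ]≈ε+ε ⟩
    ε + ε          ≈⟨ +-cong ε≈-1 ε≈-1 ⟩
    - 1ℚ + - 1ℚ    ≡⟨ solve 0 (:- con 1ℚ :+ :- con 1ℚ := :- (con 1ℚ :+ con 1ℚ)) refl ⟩
    - 2ℚ           ∎

  even⇒C[k]≈0∧ε≈-1 : ∀ k → ξ ≡ 2 ℕ.* k → C q k ≈ 0ℚ × ε ≈ - 1ℚ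
  even⇒C[k]≈0∧ε≈-1 zero ()
  even⇒C[k]≈0∧ε≈-1 k@(suc j) ξ≡2k = C[k]≈0 , (begin
    ε                               ≡⟨ cong (λ n → U q (suc n)) ξ≡2k ⟩
    U q (suc (2 ℕ.* k))             ≡⟨ U[2k+1]≡-1+U*C k ⟩
    - 1ℚ + U q (suc k) * C q k      ≈⟨ +-cong (≈-refl (- 1ℚ) (integral-neg 1ℚ integral-1)) (*-cong (U-refl (suc k)) C[k]≈0) ⟩
    - 1ℚ + U q (suc k) * 0ℚ         ≡⟨ solve 1 (λ u → :- con 1ℚ :+ u :* con 0ℚ := :- con 1ℚ) refl (U q (suc k)) ⟩
    - 1ℚ                            ∎)
    where
    integral-C : Integral (C q k)
    integral-C = integral-sub (U q (suc k)) (U q j) (integral-Uq (suc k)) (integral-Uq j)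
    U[k]*C[k]≈0 : U q k * C q k ≈ 0ℚ
    U[k]*C[k]≈0 = begin
      U q k * C q k    ≡⟨ sym (U[2k]≡U*C k) ⟩
      U q (2 ℕ.* k)    ≡⟨ cong (U q) (sym ξ≡2k) ⟩
      U q ξ            ≈⟨ U[ξ]≈0 ⟩
      0ℚ               ∎
    U[k]≉0 : ¬ U q k ≈ 0ℚ
    U[k]≉0 U[k]≈0 with no-zero-below-ξ k (subst (k <_) (sym ξ≡2k) (m<m+n k (s≤s z≤n))) U[k]≈0
    ... | ()
    C[k]≈0 : C q k ≈ 0ℚ
    C[k]≈0 = [ ⊥-elim ∘ U[k]≉0 , id ]′
      (*≈0⇒≈0⊎≈0 (U q k) (C q k) (integral-Uq k) integral-C U[k]*C[k]≈0)

open import Data.Nat using (_*_; s≤s; z≤n)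
open import Function.Bundles using (_⇔_; mk⇔)

proposition9 : (q : ℚ) (p : ℕ) → Prime p → ¬ (p ≡ 2) → ¬ InD p q →
  (ξ : ℕ) → IsIndexOfAppearance p q ξ →
  ((∃ λ m → ξ ≡ suc (2 * m)) ⇔ (InΠ₀ p q ⊎ InΠ₁ p q))
  × (InΠ₀ p q → (C q ξ ≡[ p ] 2ℚ) × (U q (suc ξ) ≡[ p ] 1ℚ))
  × (InΠ₁ p q → (C q ξ ≡[ p ] - 2ℚ) × (U q (suc ξ) ≡[ p ] - 1ℚ))
  × (∀ k → ξ ≡ 2 * k →
       (C q k ≡[ p ] Data.Rational.0ℚ) × (C q ξ ≡[ p ] - 2ℚ) × (U q (suc ξ) ≡[ p ] - 1ℚ))
-- The argument never uses that p is odd.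
proposition9 q p p-prime _ q-integral zero (() , _)
proposition9 q p p-prime _ q-integral (suc ξ′) index@(s≤s z≤n , _) =
    mk⇔ odd⇒Π₀⊎Π₁ [ proj₁ ∘ Π₀⇒odd∧ε≈1 , proj₁ ∘ Π₁⇒odd∧ε≈-1 ]′
  , (λ Π₀ → from-ε≈1 (proj₂ (Π₀⇒odd∧ε≈1 Π₀)))
  , (λ Π₁ → from-ε≈-1 (proj₂ (Π₁⇒odd∧ε≈-1 Π₁)))
  , λ k ξ≡2k → let C[k]≈0 , ε≈-1 = even⇒C[k]≈0∧ε≈-1 k ξ≡2k in congruent C[k]≈0 , from-ε≈-1 ε≈-1
  where
  open ReductionModPrime p-prime using (_≈_; congruent)
  open IndexOfAppearance p-prime q-integral index

  from-ε≈1 : ε ≈ 1ℚ → (C q (suc ξ′) ≡[ p ] 2ℚ) × (ε ≡[ p ] 1ℚ)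
  from-ε≈1 ε≈1 = congruent (ε≈1⇒C[ξ]≈2 ε≈1) , congruent ε≈1

  from-ε≈-1 : ε ≈ - 1ℚ → (C q (suc ξ′) ≡[ p ] - 2ℚ) × (ε ≡[ p ] - 1ℚ)
  from-ε≈-1 ε≈-1 = congruent (ε≈-1⇒C[ξ]≈-2 ε≈-1) , congruent ε≈-1
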